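{- Let $d\ge 2$, $n\ge d$ and $k\ge 1$ be integers, and put $c=\left\lceil n/\sum_{j=0}^k d^j\right\rceil$. Then the generalized de Bruijn digraph $G_B(n,d)$ contains a vertex $x$ such that $dx \bmod n$ lies in the modulo interval $[x+c-(d-2),\, x+c] \pmod n$; that is, there is an integer $h$ with $0\le h\le d-2$ such that $dx\equiv x+c-h \pmod n$.
   Context: The generalized de Bruijn digraph $G_B(n,d)$ has vertex set $\{0,1,\dots,n-1\}$ and an arc $(x,y)$ whenever $y\equiv dx+i \pmod n$ for some $0\le i\le d-1$. For integers $i\not\equiv j \pmod n$, the modulo interval $[i,j]\pmod n$ is the set of residues $\{i,i+1,\dots,j\}$ taken cyclically modulo $n$ (i.e. $\{i,\dots,n-1,0,\dots,j\}$ when $i \bmod n > j \bmod n$). -}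

module Defs where

open import Data.Nat using (ℕ; zero; suc; _+_; _*_; _^_; _∸_; _≤_; _<_; NonZero)
open import Data.Nat.DivMod using (_/_; _%_)
open import Data.Integer as ℤ using (ℤ; +_)
open import Data.Integer.DivMod using (_%ℕ_)
open import Data.Product using (Σ; _×_)
open import Relation.Binary.PropositionalEquality using (_≡_)

posPowSum : ℕ → ℕ → ℕ
posPowSum d zero    = 0
posPowSum d (suc k) = posPowSum d k + d ^ suc k

-- Σ_{j=0}^{k} d^j  = 1 + Σ_{j=1}^{k} d^j  (written with suc so it is visibly nonzero)
geomSum : ℕ → ℕ → ℕ
geomSum d k = suc (posPowSum d k)

⌈_/_⌉ : (m q : ℕ) → .{{NonZero q}} → ℕ
⌈ m / q ⌉ = (m + q ∸ 1) / q

-- modulo interval [i, j] (mod n), for integers i ≢ j (mod n): the residues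
-- i, i+1, ..., j taken cyclically mod n.  A residue r lies in it
-- iff r < n and (r - i) mod n ≤ (j - i) mod n.
_∈[_,_]mod_ : ℕ → ℤ → ℤ → (n : ℕ) → .{{NonZero n}} → Set
r ∈[ i , j ]mod n = r < n × ((+ r ℤ.- i) %ℕ n) ≤ ((j ℤ.- i) %ℕ n)

-- With m = d - 1, write c = q m + h with 0 ≤ h < m.  Then d q + h = q + (q m + h) = q + c,
-- so x = q mod n satisfies d x ≡ x + c - h (mod n) with h ≤ d - 2.  The particular value
-- of c plays no role.

module Submission where

open import Defs
open import Data.Nat using (ℕ; zero; suc; _+_; _*_; _∸_; _≤_; _<_; _⊔_; NonZero; s≤s)
open import Data.Nat.DivMod using (_/_; _%_; m≡m%n+[m/n]*n; [m+kn]%n≡m%n; m%n<n)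
open import Data.Nat.Divisibility using (_∣_; divides; >⇒∤)
import Data.Nat.Properties as ℕ
import Data.Nat.Tactic.RingSolver as ℕ-Solver
open import Data.Integer as ℤ using (ℤ; +_; ∣_∣)
open import Data.Integer.DivMod using (_%ℕ_; _/ℕ_; a≡a%ℕn+[a/ℕn]*n; n%ℕd<d)
import Data.Integer.Properties as ℤ
import Data.Integer.Tactic.RingSolver as ℤ-Solver
open import Data.Product using (Σ; ∃-syntax; _×_; _,_)
open import Relation.Binary.PropositionalEquality
open import Relation.Nullary using (contradiction)
open ≡-Reasoning

n∣m∧m<n⇒m≡0 : ∀ {m n} → n ∣ m → m < n → m ≡ 0
n∣m∧m<n⇒m≡0 {zero}  _   _   = refl
n∣m∧m<n⇒m≡0 {suc m} n∣m m<n = contradiction n∣m (>⇒∤ m<n)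

%ℕ-unique : ∀ {n t} .{{_ : NonZero n}} (z k : ℤ) → t < n → z ≡ + t ℤ.+ k ℤ.* + n → z %ℕ n ≡ t
%ℕ-unique {n} {t} z k t<n z≡t+kn = ℤ.+-injective (ℤ.i-j≡0⇒i≡j (+ r) (+ t) (ℤ.∣i∣≡0⇒i≡0 ∣r-t∣≡0))
  where
  r = z %ℕ n
  q = z /ℕ n
  r-t≡[k-q]n : + r ℤ.- + t ≡ (k ℤ.- q) ℤ.* + n
  r-t≡[k-q]n = begin
    + r ℤ.- + t
      ≡⟨ rearrange (+ r) (+ t) k q (+ n) ⟩
    (+ r ℤ.+ q ℤ.* + n) ℤ.- (+ t ℤ.+ k ℤ.* + n) ℤ.+ (k ℤ.- q) ℤ.* + n
      ≡⟨ cong (λ w → w ℤ.- (+ t ℤ.+ k ℤ.* + n) ℤ.+ (k ℤ.- q) ℤ.* + n)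
              (trans (sym (a≡a%ℕn+[a/ℕn]*n z n)) z≡t+kn) ⟩
    (+ t ℤ.+ k ℤ.* + n) ℤ.- (+ t ℤ.+ k ℤ.* + n) ℤ.+ (k ℤ.- q) ℤ.* + n
      ≡⟨ cancel (+ t ℤ.+ k ℤ.* + n) ((k ℤ.- q) ℤ.* + n) ⟩
    (k ℤ.- q) ℤ.* + n ∎
    where
    rearrange : ∀ r t k q n → r ℤ.- t ≡ (r ℤ.+ q ℤ.* n) ℤ.- (t ℤ.+ k ℤ.* n) ℤ.+ (k ℤ.- q) ℤ.* n
    rearrange = ℤ-Solver.solve-∀
    cancel : ∀ a b → a ℤ.- a ℤ.+ b ≡ b
    cancel = ℤ-Solver.solve-∀
  ∣r-t∣<n : ∣ + r ℤ.- + t ∣ < n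
  ∣r-t∣<n = ℕ.≤-<-trans (subst (_≤ r ⊔ t) (cong ∣_∣ (sym (ℤ.m-n≡m⊖n r t))) (ℤ.∣m⊝n∣≤m⊔n r t))
                        (ℕ.⊔-lub (n%ℕd<d z n) t<n)
  ∣r-t∣≡0 : ∣ + r ℤ.- + t ∣ ≡ 0
  ∣r-t∣≡0 = n∣m∧m<n⇒m≡0
    (divides ∣ k ℤ.- q ∣ (trans (cong ∣_∣ r-t≡[k-q]n) (ℤ.abs-* (k ℤ.- q) (+ n)))) ∣r-t∣<n

m%n≡o%n⇒m-o≡[m/n-o/n]*n : ∀ m o n .{{_ : NonZero n}} → m % n ≡ o % n →
  + m ℤ.- + o ≡ (+ (m / n) ℤ.- + (o / n)) ℤ.* + n
m%n≡o%n⇒m-o≡[m/n-o/n]*n m o n m%n≡o%n = begin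
  + m ℤ.- + o
    ≡⟨ cong₂ ℤ._-_ (a≡a%ℕn+[a/ℕn]*n (+ m) n) (a≡a%ℕn+[a/ℕn]*n (+ o) n) ⟩
  (+ (m % n) ℤ.+ + (m / n) ℤ.* + n) ℤ.- (+ (o % n) ℤ.+ + (o / n) ℤ.* + n)
    ≡⟨ cong (λ r → (+ r ℤ.+ + (m / n) ℤ.* + n) ℤ.- (+ (o % n) ℤ.+ + (o / n) ℤ.* + n)) m%n≡o%n ⟩
  (+ (o % n) ℤ.+ + (m / n) ℤ.* + n) ℤ.- (+ (o % n) ℤ.+ + (o / n) ℤ.* + n)
    ≡⟨ cancel (+ (o % n)) (+ (m / n)) (+ (o / n)) (+ n) ⟩
  (+ (m / n) ℤ.- + (o / n)) ℤ.* + n ∎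
  where
  cancel : ∀ r a b n → (r ℤ.+ a ℤ.* n) ℤ.- (r ℤ.+ b ℤ.* n) ≡ (a ℤ.- b) ℤ.* n
  cancel = ℤ-Solver.solve-∀

%≡⇒∈[-,]mod : ∀ {m h a w n} .{{_ : NonZero n}} → (m + h) % n ≡ a % n → h ≤ w → w < n →
  (m % n) ∈[ + a ℤ.- + w , + a ]mod n
%≡⇒∈[-,]mod {m} {h} {a} {w} {n} m+h≡a h≤w w<n =
  m%n<n m n , subst₂ _≤_ (sym offset-of-m%n) (sym offset-of-a) (ℕ.m∸n≤m w h)
  where
  D = + ((m + h) / n) ℤ.- + (a / n)
  M = + (m / n)
  offset-of-m%n : (+ (m % n) ℤ.- (+ a ℤ.- + w)) %ℕ n ≡ w ∸ h
  offset-of-m%n = %ℕ-unique _ (D ℤ.- M) (ℕ.≤-<-trans (ℕ.m∸n≤m w h) w<n) (begin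
    + (m % n) ℤ.- (+ a ℤ.- + w)
      ≡⟨ cong (λ w′ → + (m % n) ℤ.- (+ a ℤ.- w′)) w≡[w∸h]+h ⟩
    + (m % n) ℤ.- (+ a ℤ.- (+ (w ∸ h) ℤ.+ + h))
      ≡⟨ rearrange (+ (m % n)) M (+ h) (+ a) (+ (w ∸ h)) (+ n) ⟩
    + (w ∸ h) ℤ.+ ((+ (m % n) ℤ.+ M ℤ.* + n) ℤ.+ + h ℤ.- + a) ℤ.- M ℤ.* + n
      ≡⟨ cong (λ z → + (w ∸ h) ℤ.+ (z ℤ.+ + h ℤ.- + a) ℤ.- M ℤ.* + n) (sym (a≡a%ℕn+[a/ℕn]*n (+ m) n)) ⟩
    + (w ∸ h) ℤ.+ (+ (m + h) ℤ.- + a) ℤ.- M ℤ.* + n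
      ≡⟨ cong (λ z → + (w ∸ h) ℤ.+ z ℤ.- M ℤ.* + n) (m%n≡o%n⇒m-o≡[m/n-o/n]*n (m + h) a n m+h≡a) ⟩
    + (w ∸ h) ℤ.+ D ℤ.* + n ℤ.- M ℤ.* + n
      ≡⟨ collect (+ (w ∸ h)) D M (+ n) ⟩
    + (w ∸ h) ℤ.+ (D ℤ.- M) ℤ.* + n ∎)
    where
    w≡[w∸h]+h : + w ≡ + (w ∸ h) ℤ.+ + h
    w≡[w∸h]+h = trans (cong +_ (sym (ℕ.m∸n+n≡m h≤w))) (ℤ.pos-+ (w ∸ h) h)
    rearrange : ∀ r M h a v n → r ℤ.- (a ℤ.- (v ℤ.+ h)) ≡ v ℤ.+ ((r ℤ.+ M ℤ.* n) ℤ.+ h ℤ.- a) ℤ.- M ℤ.* n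
    rearrange = ℤ-Solver.solve-∀
    collect : ∀ v D M n → v ℤ.+ D ℤ.* n ℤ.- M ℤ.* n ≡ v ℤ.+ (D ℤ.- M) ℤ.* n
    collect = ℤ-Solver.solve-∀
  offset-of-a : (+ a ℤ.- (+ a ℤ.- + w)) %ℕ n ≡ w
  offset-of-a = %ℕ-unique _ (+ 0) w<n (cancel (+ a) (+ w) (+ n))
    where
    cancel : ∀ a w n → a ℤ.- (a ℤ.- w) ≡ w ℤ.+ + 0 ℤ.* n
    cancel = ℤ-Solver.solve-∀

[1+m]*[c/m]+c%m≡c/m+c : ∀ m c .{{_ : NonZero m}} → suc m * (c / m) + c % m ≡ c / m + c
[1+m]*[c/m]+c%m≡c/m+c m c = begin
  suc m * (c / m) + c % m    ≡⟨ rearrange m (c / m) (c % m) ⟩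
  c / m + (c % m + c / m * m) ≡⟨ cong (λ s → c / m + s) (sym (m≡m%n+[m/n]*n c m)) ⟩
  c / m + c                  ∎
  where
  rearrange : ∀ m q s → suc m * q + s ≡ q + (s + q * m)
  rearrange = ℕ-Solver.solve-∀

∃-dilation-shift : ∀ m n c .{{_ : NonZero m}} .{{_ : NonZero n}} →
  ∃[ x ] x < n × ∃[ h ] h < m × (suc m * x + h) % n ≡ (x + c) % n
∃-dilation-shift m n c = x , m%n<n q n , c % m , m%n<n c m , (begin
  (suc m * x + c % m) % n                       ≡⟨ [m+kn]%n≡m%n (suc m * x + c % m) (suc m * (q / n)) n ⟨
  (suc m * x + c % m + suc m * (q / n) * n) % n ≡⟨ cong (_% n) (lift-dilation (suc m) x (c % m) (q / n) n) ⟩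
  (suc m * (x + q / n * n) + c % m) % n         ≡⟨ cong (λ y → (suc m * y + c % m) % n) (m≡m%n+[m/n]*n q n) ⟨
  (suc m * q + c % m) % n                       ≡⟨ cong (_% n) ([1+m]*[c/m]+c%m≡c/m+c m c) ⟩
  (q + c) % n                                   ≡⟨ cong (λ y → (y + c) % n) (m≡m%n+[m/n]*n q n) ⟩
  (x + q / n * n + c) % n                       ≡⟨ cong (_% n) (lift-shift x c (q / n) n) ⟩
  (x + c + q / n * n) % n                       ≡⟨ [m+kn]%n≡m%n (x + c) (q / n) n ⟩
  (x + c) % n                                   ∎)
  where
  q = c / m
  x = q % n
  lift-dilation : ∀ d x h k n → d * x + h + d * k * n ≡ d * (x + k * n) + h
  lift-dilation = ℕ-Solver.solve-∀
  lift-shift : ∀ x c k n → x + k * n + c ≡ x + c + k * n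
  lift-shift = ℕ-Solver.solve-∀

lemma2p2 : (d n k : ℕ) → 2 ≤ d → d ≤ n → 1 ≤ k → .{{_ : NonZero n}} →
    Σ ℕ (λ x → x < n ×
    ((d * x) % n) ∈[ + (x + ⌈ n / geomSum d k ⌉) ℤ.- + (d ∸ 2) , + (x + ⌈ n / geomSum d k ⌉) ]mod n)
lemma2p2 (suc zero) n k (s≤s ()) _ _
lemma2p2 (suc (suc e)) n k _ d≤n _
  with ∃-dilation-shift (suc e) n ⌈ n / geomSum (suc (suc e)) k ⌉
... | x , x<n , h , h<1+e , shift = x , x<n , %≡⇒∈[-,]mod shift (ℕ.≤-pred h<1+e) e<n
  where
  e<n : e < n
  e<n = ℕ.≤-trans (ℕ.n≤1+n (suc e)) d≤n
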